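{- For every agent $i$ and every formula $\phi$ of $\mathbf{LUT}$: if $\vDash\phi$, then $\vDash\neg U_i\phi$.
   Context: Let $\mathbf{P}$ be a countably infinite set of propositional variables and $\mathbf{I}$ a finite set of agents. The language $\mathbf{LUT}$ is given by $\phi::= p\mid\neg\phi\mid(\phi\land\phi)\mid K_i\phi\mid[\phi]\phi\mid U_i\phi$ ($p\in\mathbf{P}$, $i\in\mathbf{I}$); $\mathbf{EL}$ is the fragment without $[\cdot]$ and $U_i$. A model is $\mathcal{M}=\langle S,\{R_i\}_{i\in\mathbf{I}},V\rangle$ with $S\neq\emptyset$, each $R_i$ a reflexive relation on $S$, $V:\mathbf{P}\to2^S$. Truth: $p$ true at $s$ iff $s\in V(p)$; Boolean clauses as usual; $\mathcal{M},s\vDash K_i\phi$ iff $\phi$ holds at all $t$ with $sR_it$; $\mathcal{M},s\vDash[\psi]\phi$ iff ($\mathcal{M},s\vDash\psi$ implies $\mathcal{M}|_\psi,s\vDash\phi$), with $\mathcal{M}|_\psi$ the restriction of $\mathcal{M}$ to the states where $\psi$ is true; $\mathcal{M},s\vDash U_i\phi$ iff $\mathcal{M},s\vDash\phi$ and for all $\psi\in\mathbf{EL}$, $\mathcal{M},s\vDash[\psi]\neg K_i\phi$. $\vDash\phi$ means $\phi$ is true at every state of every model. -}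

module Defs where

open import Data.Nat using (ℕ)
open import Data.Fin using (Fin)
open import Data.Product using (Σ; _×_; _,_; proj₁)
open import Relation.Nullary using (¬_)

Prop : Set
Prop = ℕ

module _ (n : ℕ) where

  Agent : Set
  Agent = Fin n

  data LUT : Set where
    var  : Prop → LUT
    ¬'_  : LUT → LUT
    _∧'_ : LUT → LUT → LUT
    K    : Agent → LUT → LUT
    [_]_ : LUT → LUT → LUT
    U    : Agent → LUT → LUT

  data EL : Set where
    var  : Prop → EL
    ¬'_  : EL → EL
    _∧'_ : EL → EL → EL
    K    : Agent → EL → EL

  embed : EL → LUT
  embed (var p) = var p
  embed (¬' φ) = ¬' embed φ
  embed (φ ∧' ψ) = embed φ ∧' embed ψ
  embed (K i φ) = K i (embed φ)

  record Model : Set₁ where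
    field
      S     : Set
      R     : Agent → S → S → Set
      R-refl : ∀ i s → R i s s
      V     : Prop → S → Set
  open Model public

  restrictTo : (M : Model) → (S M → Set) → Model
  restrictTo M P = record
    { S = Σ (S M) P
    ; R = λ i s t → R M i (proj₁ s) (proj₁ t)
    ; R-refl = λ i s → R-refl M i (proj₁ s)
    ; V = λ p s → V M p (proj₁ s)
    }

  satEL : (M : Model) → S M → EL → Set
  satEL M s (var p) = V M p s
  satEL M s (¬' φ) = ¬ satEL M s φ
  satEL M s (φ ∧' ψ) = satEL M s φ × satEL M s ψ
  satEL M s (K i φ) = ∀ t → R M i s t → satEL M t φ

  -- truth of LUT formulas.
  -- The U clause unfolds "for all ψ ∈ EL, M,s ⊨ [ψ]¬K_i φ" via the clauses
  -- for [·], ¬ and K (truth of an EL formula ψ read in LUT is satEL).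
  sat : (M : Model) → S M → LUT → Set
  sat M s (var p) = V M p s
  sat M s (¬' φ) = ¬ sat M s φ
  sat M s (φ ∧' ψ) = sat M s φ × sat M s ψ
  sat M s (K i φ) = ∀ t → R M i s t → sat M t φ
  sat M s ([ ψ ] φ) =
    (h : sat M s ψ) → sat (restrictTo M (λ t → sat M t ψ)) (s , h) φ
  sat M s (U i φ) =
    sat M s φ ×
    (∀ (ψ : EL) → (h : satEL M s ψ) →
      ¬ (∀ t → R (restrictTo M (λ u → satEL M u ψ)) i (s , h) t
               → sat (restrictTo M (λ u → satEL M u ψ)) t φ))

  Valid : LUT → Set₁
  Valid φ = ∀ (M : Model) (s : S M) → sat M s φ

{-# OPTIONS --safe #-}
module Submission where

open import Defs
open import Data.Nat using (ℕ)
open import Data.Product using (_,_)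

-- U_i φ requires φ to become unknown after some true EL announcement. A valid φ
-- stays true in every restricted model, so after announcing a tautology it is
-- still known, and U_i φ fails.

module _ {n : ℕ} where

  ⊤ᴱᴸ : EL n
  ⊤ᴱᴸ = ¬' (var 0 ∧' (¬' var 0))

  satEL-⊤ᴱᴸ : (M : Model n) (s : S M) → satEL n M s ⊤ᴱᴸ
  satEL-⊤ᴱᴸ M s (p , ¬p) = ¬p p

  valid⇒known : (φ : LUT n) → Valid n φ →
                (i : Agent n) (M : Model n) (s : S M) → sat n M s (K i φ)
  valid⇒known φ valid i M s t _ = valid M t

mainTheorem15 : (n : ℕ) (i : Agent n) (φ : LUT n) →
    Valid n φ → Valid n (¬' (U i φ))
mainTheorem15 n i φ valid M s (_ , unknownAfterAnnouncements) =
  unknownAfterAnnouncements ⊤ᴱᴸ (satEL-⊤ᴱᴸ M s)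
    (valid⇒known φ valid i (restrictTo n M (λ u → satEL n M u ⊤ᴱᴸ)) (s , satEL-⊤ᴱᴸ M s))
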